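{- Let $A$ and $B$ be permutations with $A$ pseudo-cancelable. If the equation $AX=B$ admits a solution (a permutation $X$), then the following procedure returns the solution maximizing the number of connected components: set $X=\mathbf{0}$; while $B\neq\mathbf{0}$, let $a$ and $b$ be the multiplicities of the cycle $C_{\ell(B)}$ in $A\,C_{\mathrm{alcm}_A B}$ and in $B$ respectively, and set $X\leftarrow X+\tfrac{b}{a}C_{\mathrm{alcm}_A B}$ and $B\leftarrow B-\tfrac{b}{a}A\,C_{\mathrm{alcm}_A B}$; if at any moment $|A|>|B|$ or $A\,C_{\mathrm{alcm}_A B}$ is not a submultiset of $B$, the procedure declares the quotient undefined; otherwise it returns the final $X$.
   Context: A permutation is a finite set with a bijection on it up to isomorphism, i.e. a multiset (sum) of cycles, $C_n$ denoting the cycle of length $n$ and $\mathbf{0}$ the empty permutation; $|A|$ is the number of states. Sum is disjoint union; product is the direct product of digraphs, so $C_aC_b=\gcd(a,b)\,C_{\lcm(a,b)}$. $A$ is a submultiset of $B$ if $B=A+C$ for some $C$, and then $B-A=C$. For nonzero $A$, $\ell(A)$ is the smallest cycle length in $A$; $A$ is pseudo-cancelable if every cycle length of $A$ is a multiple of $\ell(A)$. For integers $a\mid b$, $\mathrm{alcm}_a b$ is the smallest positive $c$ with $\lcm(a,c)=b$, and $\mathrm{alcm}_A B=\mathrm{alcm}_{\ell(A)}\ell(B)$. -}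

module Defs where

open import Data.Nat using (ℕ; zero; suc; _+_; _*_; _≤_; _<_; _⊓_; _≟_)
open import Data.Nat.GCD using (gcd)
open import Data.Nat.LCM using (lcm)
open import Data.Nat.Divisibility using (_∣_)
open import Data.List using (List; []; _∷_; _++_; concatMap; replicate; length; foldr; [_])
open import Data.Nat.ListAction using (sum)
open import Data.List.Relation.Unary.All using (All)
open import Data.List.Relation.Binary.Permutation.Propositional using (_↭_)
open import Data.Product using (Σ; _×_; ∃)
open import Relation.Binary.PropositionalEquality using (_≡_; _≢_)
open import Relation.Nullary using (¬_; yes; no)

-- A permutation (up to isomorphism) is a finite multiset of cycles.
-- We represent it by the list of its cycle lengths (C_n is the entry n);
-- two representations denote the same permutation iff they are related by _↭_.
Perm : Set
Perm = List ℕ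

IsPerm : Perm → Set
IsPerm A = All (λ n → 0 < n) A

𝟘 : Perm
𝟘 = []

C : ℕ → Perm
C n = [ n ]

_⊕_ : Perm → Perm → Perm
A ⊕ B = A ++ B

-- direct product, determined by C_a C_b = gcd(a,b) C_lcm(a,b) and distributivity
_⊗_ : Perm → Perm → Perm
A ⊗ B = concatMap (λ a → concatMap (λ b → replicate (gcd a b) (lcm a b)) B) A

_·_ : ℕ → Perm → Perm
zero · A = []
suc k · A = A ⊕ (k · A)

-- |A| = number of states
size : Perm → ℕ
size A = sum A

components : Perm → ℕ
components A = length A

mult : ℕ → Perm → ℕ
mult n [] = 0
mult n (m ∷ A) with n ≟ m
... | yes _ = suc (mult n A)
... | no _ = mult n A

_⊑_ : Perm → Perm → Set
A ⊑ B = ∃ λ D → B ↭ (A ⊕ D)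

-- ℓ(A): smallest cycle length (only meaningful for A ≠ 0)
ℓ : Perm → ℕ
ℓ [] = 0
ℓ (x ∷ xs) = foldr _⊓_ x xs

PseudoCancelable : Perm → Set
PseudoCancelable A = (A ≢ 𝟘) × All (λ n → ℓ A ∣ n) A

IsAlcm : ℕ → ℕ → ℕ → Set
IsAlcm a b c = (0 < c) × (lcm a c ≡ b) × (∀ d → 0 < d → lcm a d ≡ b → c ≤ d)

IsSolution : Perm → Perm → Perm → Set
IsSolution A B X = IsPerm X × ((A ⊗ X) ↭ B)

-- Runs A B X : the division procedure, run on A and B (starting with the
-- accumulator 0), terminates without declaring the quotient undefined and
-- returns X.  One constructor per loop iteration; the procedure is
-- deterministic (up to reordering of cycles), so a successful run exists iff
-- the procedure succeeds.  A run gets stuck (= "undefined") exactly when some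
-- check fails: |A| > |B|, A C_alcm not a submultiset of B, alcm undefined,
-- b/a not a natural number, or (b/a) A C_alcm not a submultiset of B
-- (subtraction undefined).
data Runs (A : Perm) : Perm → Perm → Set where
  done : Runs A 𝟘 𝟘
  step : ∀ {B B' X c k} →
         B ≢ 𝟘 →
         IsAlcm (ℓ A) (ℓ B) c →
         -- k = b / a with a = mult ℓ(B) in A C_c, b = mult ℓ(B) in B
         k * mult (ℓ B) (A ⊗ C c) ≡ mult (ℓ B) B →
         ¬ (size B < size A) →
         (A ⊗ C c) ⊑ B →
         -- B' = B - k (A C_c)
         B ↭ ((k · (A ⊗ C c)) ⊕ B') →
         Runs A B' X →
         Runs A B ((k · C c) ⊕ X)

module Submission where

-- Let a = ℓ(A), which divides every cycle length of A, let B = AY and m = ℓ(B).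
-- A cycle C_m of B comes from some x ∈ A and y ∈ Y with lcm(x,y) = m; since
-- lcm(a,y) divides m and is itself a cycle length of B, lcm(a,y) = m.  Every
-- such y is a multiple t·c of c = alcm_a m (the d with lcm(a,d) = m are closed
-- under gcd), and then A C_y = t·(A C_c).  So B = K·(A C_c) + A Y', where Y'
-- collects the cycles y with lcm(a,y) ≠ m and A Y' has no cycle of length m.
-- Comparing multiplicities of C_m shows that K is the same for every solution
-- Y, hence the procedure's step is forced, Y' is a solution for the rest, and Y
-- has at most K + |Y'| cycles.  Induction on the number of cycles of Y
-- concludes.

open import Defs
import Algebra.Properties.CommutativeSemigroup as CommSemigroup
open import Data.List using ([]; _∷_; _++_; concatMap; replicate; length; filter)
open import Data.List.Properties
  using (++-identityʳ; ++-assoc; length-++; filter-some; filter-notAll; foldr-preservesᵒ)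
open import Data.List.Membership.Propositional using (_∈_; _∉_; find)
open import Data.List.Membership.Propositional.Properties
  using (∈-∃++; ∈-concatMap⁺; ∈-concatMap⁻; ∈-filter⁻; foldr-selective)
open import Data.List.Relation.Unary.All using (All; []; _∷_; lookup)
open import Data.List.Relation.Unary.All.Properties using (++⁺; all-filter; filter⁺)
open import Data.List.Relation.Unary.Any as Any using (Any; here; there)
open import Data.List.Relation.Binary.Permutation.Propositional as ↭
  using (_↭_; ↭-refl; ↭-sym; ↭-trans; ↭-reflexive)
open import Data.List.Relation.Binary.Permutation.Propositional.Properties
  using (shift; ∈-resp-↭)
open import Data.Nat using (ℕ; zero; suc; _+_; _*_; _≤_; _<_; _⊓_; _≟_; _<?_; z≤n; z<s; NonZero; >-nonZero)
open import Data.Nat.Properties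
open import Data.Nat.Divisibility using (_∣_; divides; ∣-trans; ∣-antisym; ∣⇒≤; ∣n⇒∣m*n; *-monoʳ-∣)
open import Data.Nat.DivMod using (_/_; m/n*n≡m)
open import Data.Nat.GCD using (gcd; gcd[m,n]∣m; gcd[m,n]∣n; gcd[m,n]≢0)
open import Data.Nat.LCM using (lcm; m∣lcm[m,n]; n∣lcm[m,n]; lcm-least; gcd*lcm)
open import Data.Nat.Coprimality using (coprime-/gcd; coprime-factors)
open import Data.Nat.Induction using (<-rec)
open import Data.Nat.ListAction.Properties using (sum-++; sum-↭)
open import Data.Product using (_×_; ∃; _,_; proj₁; proj₂)
open import Data.Sum using (_⊎_; inj₁; inj₂; [_,_]′)
open import Function using (_∘_)
open import Relation.Binary.PropositionalEquality
  using (_≡_; _≢_; refl; sym; trans; cong; cong₂; subst; module ≡-Reasoning)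
open import Relation.Nullary using (yes; no; contradiction)
open import Relation.Nullary.Decidable using (_×-dec_)
open import Relation.Unary using (Pred; Decidable)
open import Relation.Unary.Properties using (∁?)

open ≡-Reasoning
open CommSemigroup +-commutativeSemigroup using (interchange; x∙yz≈y∙xz)
open CommSemigroup *-commutativeSemigroup using () renaming (x∙yz≈y∙xz to *-exchange)

-- Multiplicities and least cycle lengths

mult-⊕ : ∀ n A B → mult n (A ⊕ B) ≡ mult n A + mult n B
mult-⊕ n []      B = refl
mult-⊕ n (x ∷ A) B with n ≟ x
... | yes _ = cong suc (mult-⊕ n A B)
... | no  _ = mult-⊕ n A B

mult-· : ∀ n k A → mult n (k · A) ≡ k * mult n A
mult-· n zero    A = refl
mult-· n (suc k) A = trans (mult-⊕ n A (k · A)) (cong (mult n A +_) (mult-· n k A))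

mult-head : ∀ n A → mult n (n ∷ A) ≡ suc (mult n A)
mult-head n A with n ≟ n
... | yes _   = refl
... | no  n≢n = contradiction refl n≢n

∈⇒mult>0 : ∀ {n A} → n ∈ A → 0 < mult n A
∈⇒mult>0 {n} {_ ∷ A} (here refl) = subst (0 <_) (sym (mult-head n A)) z<s
∈⇒mult>0 {n} {x ∷ A} (there n∈A) with n ≟ x
... | yes _ = z<s
... | no  _ = ∈⇒mult>0 n∈A

mult>0⇒∈ : ∀ {n} A → 0 < mult n A → n ∈ A
mult>0⇒∈ {n} (x ∷ A) 0<mult with n ≟ x
... | yes refl = here refl
... | no  _    = there (mult>0⇒∈ A 0<mult)

∉⇒mult≡0 : ∀ {n A} → n ∉ A → mult n A ≡ 0
∉⇒mult≡0 {A = A} n∉A = n≤0⇒n≡0 (≮⇒≥ (n∉A ∘ mult>0⇒∈ A))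

↭⇒mult≡ : ∀ {A B} → A ↭ B → ∀ n → mult n A ≡ mult n B
↭⇒mult≡ ↭.refl               n = refl
↭⇒mult≡ (↭.prep x A↭B)       n with n ≟ x
... | yes _ = cong suc (↭⇒mult≡ A↭B n)
... | no  _ = ↭⇒mult≡ A↭B n
↭⇒mult≡ {x ∷ y ∷ A} {y ∷ x ∷ B} (↭.swap x y A↭B) n = begin
  mult n ((C x ⊕ C y) ⊕ A)          ≡⟨ mult-⊕ n (C x ⊕ C y) A ⟩
  mult n (C x ⊕ C y) + mult n A     ≡⟨ cong₂ _+_ pair-comm (↭⇒mult≡ A↭B n) ⟩
  mult n (C y ⊕ C x) + mult n B     ≡⟨ mult-⊕ n (C y ⊕ C x) B ⟨
  mult n ((C y ⊕ C x) ⊕ B)          ∎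
  where
  pair-comm : mult n (C x ⊕ C y) ≡ mult n (C y ⊕ C x)
  pair-comm = trans (mult-⊕ n (C x) (C y))
    (trans (+-comm (mult n (C x)) (mult n (C y))) (sym (mult-⊕ n (C y) (C x))))
↭⇒mult≡ (↭.trans A↭B B↭C)    n = trans (↭⇒mult≡ A↭B n) (↭⇒mult≡ B↭C n)

mult≡⇒↭ : ∀ A B → (∀ n → mult n A ≡ mult n B) → A ↭ B
mult≡⇒↭ []      []      _  = ↭-refl
mult≡⇒↭ []      (y ∷ B) eq = contradiction (trans (eq y) (mult-head y B)) 0≢1+n
mult≡⇒↭ (x ∷ A) B       eq
  with ∈-∃++ (mult>0⇒∈ B (subst (0 <_) (eq x) (∈⇒mult>0 {A = x ∷ A} (here refl))))
... | B₁ , B₂ , refl = ↭-trans (↭.prep x (mult≡⇒↭ A (B₁ ++ B₂) eq′)) (↭-sym (shift x B₁ B₂))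
  where
  eq′ : ∀ n → mult n A ≡ mult n (B₁ ++ B₂)
  eq′ n = +-cancelˡ-≡ (mult n (C x)) _ _ (begin
    mult n (C x) + mult n A          ≡⟨ mult-⊕ n (C x) A ⟨
    mult n (x ∷ A)                   ≡⟨ eq n ⟩
    mult n (B₁ ++ x ∷ B₂)            ≡⟨ ↭⇒mult≡ (shift x B₁ B₂) n ⟩
    mult n (x ∷ B₁ ++ B₂)            ≡⟨ mult-⊕ n (C x) (B₁ ++ B₂) ⟩
    mult n (C x) + mult n (B₁ ++ B₂) ∎)

ℓ-∈ : ∀ x A → ℓ (x ∷ A) ∈ x ∷ A
ℓ-∈ x A = [ here , there ]′ (foldr-selective ⊓-sel x A)

ℓ-≤ : ∀ {y} A → y ∈ A → ℓ A ≤ y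
ℓ-≤ {y} (x ∷ A) y∈ = foldr-preservesᵒ ⊓-≤ x A (split y∈)
  where
  ⊓-≤ : ∀ u v → u ≤ y ⊎ v ≤ y → u ⊓ v ≤ y
  ⊓-≤ u v = [ ≤-trans (m⊓n≤m u v) , ≤-trans (m⊓n≤n u v) ]′
  split : y ∈ x ∷ A → x ≤ y ⊎ Any (_≤ y) A
  split (here refl)  = inj₁ ≤-refl
  split (there y∈A) = inj₂ (Any.map (≤-reflexive ∘ sym) y∈A)

-- Products of permutations

∈-replicate⁺ : ∀ {T : Set} {k} {x : T} → 0 < k → x ∈ replicate k x
∈-replicate⁺ {k = suc _} _ = here refl

∈-replicate⁻ : ∀ {T : Set} {k} {x y : T} → y ∈ replicate k x → y ≡ x
∈-replicate⁻ {k = suc _} (here y≡x) = y≡x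
∈-replicate⁻ {k = suc _} (there y∈) = ∈-replicate⁻ y∈

replicate≡· : ∀ k l → replicate k l ≡ k · C l
replicate≡· zero    l = refl
replicate≡· (suc k) l = cong (l ∷_) (replicate≡· k l)

C⊗C : ∀ x y → C x ⊗ C y ≡ gcd x y · C (lcm x y)
C⊗C x y = trans (++-identityʳ _) (trans (++-identityʳ _) (replicate≡· (gcd x y) (lcm x y)))

⊗-∷ˡ : ∀ x A Y → (x ∷ A) ⊗ Y ≡ (C x ⊗ Y) ⊕ (A ⊗ Y)
⊗-∷ˡ x A Y = cong (_⊕ (A ⊗ Y)) (sym (++-identityʳ _))

⊗-zeroʳ : ∀ A → A ⊗ 𝟘 ≡ 𝟘
⊗-zeroʳ []      = refl
⊗-zeroʳ (_ ∷ A) = ⊗-zeroʳ A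

mult-⊗-∷ˡ : ∀ n x A Y → mult n ((x ∷ A) ⊗ Y) ≡ mult n (C x ⊗ Y) + mult n (A ⊗ Y)
mult-⊗-∷ˡ n x A Y = trans (cong (mult n) (⊗-∷ˡ x A Y)) (mult-⊕ n (C x ⊗ Y) (A ⊗ Y))

mult-⊗-∷ʳ : ∀ n A y Y → mult n (A ⊗ (y ∷ Y)) ≡ mult n (A ⊗ C y) + mult n (A ⊗ Y)
mult-⊗-∷ʳ n []      y Y = refl
mult-⊗-∷ʳ n (x ∷ A) y Y = begin
  mult n ((xy ++ xY) ++ A ⊗ (y ∷ Y))            ≡⟨ mult-⊕ n (xy ++ xY) (A ⊗ (y ∷ Y)) ⟩
  mult n (xy ++ xY) + mult n (A ⊗ (y ∷ Y))       ≡⟨ cong₂ _+_ (mult-⊕ n xy xY) (mult-⊗-∷ʳ n A y Y) ⟩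
  (μ xy + μ xY) + (μ (A ⊗ C y) + μ (A ⊗ Y))     ≡⟨ interchange (μ xy) (μ xY) _ _ ⟩
  (μ xy + μ (A ⊗ C y)) + (μ xY + μ (A ⊗ Y))
    ≡⟨ cong (λ L → (μ L + μ (A ⊗ C y)) + (μ xY + μ (A ⊗ Y))) (++-identityʳ xy) ⟨
  (μ (xy ++ []) + μ (A ⊗ C y)) + (μ xY + μ (A ⊗ Y))
    ≡⟨ cong₂ _+_ (mult-⊕ n (xy ++ []) (A ⊗ C y)) (mult-⊕ n xY (A ⊗ Y)) ⟨
  μ ((x ∷ A) ⊗ C y) + μ ((x ∷ A) ⊗ Y)           ∎
  where
  μ  = mult n
  xy = replicate (gcd x y) (lcm x y)
  xY = concatMap (λ b → replicate (gcd x b) (lcm x b)) Y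

mult-⊗-⊕ʳ : ∀ n A Y Z → mult n (A ⊗ (Y ⊕ Z)) ≡ mult n (A ⊗ Y) + mult n (A ⊗ Z)
mult-⊗-⊕ʳ n A []      Z = sym (cong (λ L → mult n L + mult n (A ⊗ Z)) (⊗-zeroʳ A))
mult-⊗-⊕ʳ n A (y ∷ Y) Z = begin
  μ (A ⊗ (y ∷ Y ⊕ Z))                   ≡⟨ mult-⊗-∷ʳ n A y (Y ⊕ Z) ⟩
  μ (A ⊗ C y) + μ (A ⊗ (Y ⊕ Z))         ≡⟨ cong (μ (A ⊗ C y) +_) (mult-⊗-⊕ʳ n A Y Z) ⟩
  μ (A ⊗ C y) + (μ (A ⊗ Y) + μ (A ⊗ Z)) ≡⟨ +-assoc (μ (A ⊗ C y)) _ _ ⟨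
  (μ (A ⊗ C y) + μ (A ⊗ Y)) + μ (A ⊗ Z) ≡⟨ cong (_+ μ (A ⊗ Z)) (mult-⊗-∷ʳ n A y Y) ⟨
  μ (A ⊗ (y ∷ Y)) + μ (A ⊗ Z)           ∎
  where μ = mult n

mult-⊗-·ʳ : ∀ n A k Y → mult n (A ⊗ (k · Y)) ≡ k * mult n (A ⊗ Y)
mult-⊗-·ʳ n A zero    Y = cong (mult n) (⊗-zeroʳ A)
mult-⊗-·ʳ n A (suc k) Y =
  trans (mult-⊗-⊕ʳ n A Y (k · Y)) (cong (mult n (A ⊗ Y) +_) (mult-⊗-·ʳ n A k Y))

module _ {p} {P : Pred ℕ p} (P? : Decidable P) where

  mult-⊗-filter : ∀ n A Y →
                  mult n (A ⊗ Y) ≡ mult n (A ⊗ filter P? Y) + mult n (A ⊗ filter (∁? P?) Y)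
  mult-⊗-filter n A []      rewrite ⊗-zeroʳ A = refl
  mult-⊗-filter n A (y ∷ Y) with P? y
  ... | yes _ = begin
    μ (A ⊗ (y ∷ Y))                ≡⟨ mult-⊗-∷ʳ n A y Y ⟩
    μ (A ⊗ C y) + μ (A ⊗ Y)        ≡⟨ cong (μ (A ⊗ C y) +_) (mult-⊗-filter n A Y) ⟩
    μ (A ⊗ C y) + (μ (A ⊗ Y₊) + r) ≡⟨ +-assoc (μ (A ⊗ C y)) (μ (A ⊗ Y₊)) r ⟨
    (μ (A ⊗ C y) + μ (A ⊗ Y₊)) + r ≡⟨ cong (_+ r) (mult-⊗-∷ʳ n A y Y₊) ⟨
    μ (A ⊗ (y ∷ Y₊)) + r           ∎
    where
    μ  = mult n
    Y₊ = filter P? Y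
    r  = μ (A ⊗ filter (∁? P?) Y)
  ... | no  _ = begin
    μ (A ⊗ (y ∷ Y))                ≡⟨ mult-⊗-∷ʳ n A y Y ⟩
    μ (A ⊗ C y) + μ (A ⊗ Y)        ≡⟨ cong (μ (A ⊗ C y) +_) (mult-⊗-filter n A Y) ⟩
    μ (A ⊗ C y) + (s + μ (A ⊗ Y₋)) ≡⟨ x∙yz≈y∙xz (μ (A ⊗ C y)) s (μ (A ⊗ Y₋)) ⟩
    s + (μ (A ⊗ C y) + μ (A ⊗ Y₋)) ≡⟨ cong (s +_) (mult-⊗-∷ʳ n A y Y₋) ⟨
    s + μ (A ⊗ (y ∷ Y₋))           ∎
    where
    μ  = mult n
    Y₋ = filter (∁? P?) Y
    s  = μ (A ⊗ filter P? Y)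

  length-filter-∁ : ∀ Y → length Y ≡ length (filter P? Y) + length (filter (∁? P?) Y)
  length-filter-∁ []      = refl
  length-filter-∁ (y ∷ Y) with P? y
  ... | yes _ = cong suc (length-filter-∁ Y)
  ... | no  _ = trans (cong suc (length-filter-∁ Y)) (sym (+-suc _ _))

∈-⊗⁺ : ∀ {x y A Y} → x ∈ A → y ∈ Y → 0 < gcd x y → lcm x y ∈ A ⊗ Y
∈-⊗⁺ x∈A y∈Y 0<gcd =
  ∈-concatMap⁺ _ (Any.map (λ { refl →
    ∈-concatMap⁺ _ (Any.map (λ { refl → ∈-replicate⁺ 0<gcd }) y∈Y) }) x∈A)

∈-⊗⁻ : ∀ {n} A Y → n ∈ A ⊗ Y → ∃ λ x → ∃ λ y → x ∈ A × y ∈ Y × lcm x y ≡ n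
∈-⊗⁻ A Y n∈AY with find (∈-concatMap⁻ _ {xs = A} n∈AY)
... | x , x∈A , n∈xY with find (∈-concatMap⁻ _ {xs = Y} n∈xY)
... | y , y∈Y , n∈xy = x , y , x∈A , y∈Y , sym (∈-replicate⁻ n∈xy)

size-· : ∀ k A → size (k · A) ≡ k * size A
size-· zero    A = refl
size-· (suc k) A = trans (sum-++ A (k · A)) (cong (size A +_) (size-· k A))

size-⊗-C : ∀ A c → size (A ⊗ C c) ≡ size A * c
size-⊗-C []      c = refl
size-⊗-C (x ∷ A) c = begin
  size ((x ∷ A) ⊗ C c)                     ≡⟨ cong size (⊗-∷ˡ x A (C c)) ⟩
  size ((C x ⊗ C c) ⊕ (A ⊗ C c))           ≡⟨ sum-++ (C x ⊗ C c) (A ⊗ C c) ⟩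
  size (C x ⊗ C c) + size (A ⊗ C c)        ≡⟨ cong₂ _+_ (cong size (C⊗C x c)) (size-⊗-C A c) ⟩
  size (gcd x c · C (lcm x c)) + size A * c ≡⟨ cong (_+ size A * c) (size-· (gcd x c) (C (lcm x c))) ⟩
  gcd x c * (lcm x c + 0) + size A * c     ≡⟨ cong (λ l → gcd x c * l + size A * c) (+-identityʳ (lcm x c)) ⟩
  gcd x c * lcm x c + size A * c           ≡⟨ cong (_+ size A * c) (gcd*lcm x c) ⟩
  x * c + size A * c                       ≡⟨ *-distribʳ-+ c x (size A) ⟨
  (x + size A) * c                         ∎

⊑⇒size≤ : ∀ {A B} → A ⊑ B → size A ≤ size B
⊑⇒size≤ {A} (D , B↭A⊕D) =
  ≤-trans (m≤m+n (size A) (size D)) (≤-reflexive (sym (trans (sum-↭ B↭A⊕D) (sum-++ A D))))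

·-⊑ : ∀ {k A B D} → 0 < k → B ↭ (k · A) ⊕ D → A ⊑ B
·-⊑ {suc k} {A} {D = D} _ B↭ = (k · A) ⊕ D , ↭-trans B↭ (↭-reflexive (++-assoc A (k · A) D))

All-· : ∀ {p} {P : Pred ℕ p} {A} k → All P A → All P (k · A)
All-· zero    _   = []
All-· (suc k) PA = ++⁺ PA (All-· k PA)

components-·-C : ∀ k c → components (k · C c) ≡ k
components-·-C zero    c = refl
components-·-C (suc k) c = cong suc (components-·-C k c)

-- Arithmetic of lcm and alcm

gcd-pos : ∀ {m} n → 0 < m → 0 < gcd m n
gcd-pos {m} n 0<m = n≢0⇒n>0 (gcd[m,n]≢0 m n (inj₁ (n>0⇒n≢0 0<m)))

lcm-pos : ∀ {m n} → 0 < m → 0 < n → 0 < lcm m n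
lcm-pos {m} {n} 0<m 0<n = n≢0⇒n>0 λ lcm≡0 →
  [ n>0⇒n≢0 0<m , n>0⇒n≢0 0<n ]′ (m*n≡0⇒m≡0∨n≡0 m (begin
    m * n             ≡⟨ gcd*lcm m n ⟨
    gcd m n * lcm m n ≡⟨ cong (gcd m n *_) lcm≡0 ⟩
    gcd m n * 0       ≡⟨ *-zeroʳ (gcd m n) ⟩
    0                 ∎))

lcm-monoˡ-∣ : ∀ {m n} k → m ∣ n → lcm m k ∣ lcm n k
lcm-monoˡ-∣ {n = n} k m∣n = lcm-least (∣-trans m∣n (m∣lcm[m,n] n k)) (n∣lcm[m,n] n k)

lcm-≡⇒∣ : ∀ {a b y z} → a ∣ b → lcm a y ≡ lcm a z → lcm b y ∣ lcm b z
lcm-≡⇒∣ {a} {b} {y} {z} a∣b eq =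
  lcm-least (m∣lcm[m,n] b z) (∣-trans (n∣lcm[m,n] a y) (subst (_∣ lcm b z) (sym eq) (lcm-monoˡ-∣ z a∣b)))

lcm-≡-lift : ∀ {a b y z} → a ∣ b → lcm a y ≡ lcm a z → lcm b y ≡ lcm b z
lcm-≡-lift a∣b eq = ∣-antisym (lcm-≡⇒∣ a∣b eq) (lcm-≡⇒∣ a∣b (sym eq))

gcd-scale : ∀ {x y c t} → 0 < x → 0 < c → y ≡ t * c → lcm x y ≡ lcm x c → gcd x y ≡ t * gcd x c
gcd-scale {x} {y} {c} {t} 0<x 0<c y≡tc lcm≡ =
  *-cancelʳ-≡ (gcd x y) (t * gcd x c) (lcm x c) {{>-nonZero (lcm-pos 0<x 0<c)}} (begin
    gcd x y * lcm x c       ≡⟨ cong (gcd x y *_) lcm≡ ⟨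
    gcd x y * lcm x y       ≡⟨ gcd*lcm x y ⟩
    x * y                   ≡⟨ cong (x *_) y≡tc ⟩
    x * (t * c)             ≡⟨ *-exchange x t c ⟩
    t * (x * c)             ≡⟨ cong (t *_) (gcd*lcm x c) ⟨
    t * (gcd x c * lcm x c) ≡⟨ *-assoc t (gcd x c) (lcm x c) ⟨
    t * gcd x c * lcm x c   ∎)

lcm-∣-quotient : ∀ a {g} x .{{_ : NonZero g}} → g ∣ x → lcm a x ∣ (x / g) * lcm a g
lcm-∣-quotient a {g} x g∣x = lcm-least (∣n⇒∣m*n (x / g) (m∣lcm[m,n] a g))
  (subst (_∣ (x / g) * lcm a g) (m/n*n≡m g∣x) (*-monoʳ-∣ (x / g) (n∣lcm[m,n] a g)))

-- With g = gcd c y, the quotients c/g and y/g are coprime and lcm a c divides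
-- both (c/g) * lcm a g and (y/g) * lcm a g.
lcm-gcd-closed : ∀ a {c y} → 0 < c → lcm a y ≡ lcm a c → lcm a (gcd c y) ≡ lcm a c
lcm-gcd-closed a {c} {y} 0<c eq = ∣-antisym
  (lcm-least (m∣lcm[m,n] a c) (∣-trans (gcd[m,n]∣m c y) (n∣lcm[m,n] a c)))
  (coprime-factors (coprime-/gcd c y)
    ( lcm-∣-quotient a c (gcd[m,n]∣m c y)
    , subst (_∣ (y / g) * lcm a g) eq (lcm-∣-quotient a y (gcd[m,n]∣n c y))))
  where
  g = gcd c y
  instance
    g≢0 : NonZero g
    g≢0 = >-nonZero (gcd-pos y 0<c)

Least : ∀ {p} → Pred ℕ p → Pred ℕ p
Least P c = P c × (∀ {d} → P d → c ≤ d)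

least-witness : ∀ {p} {P : Pred ℕ p} → Decidable P → ∀ {n} → P n → ∃ (Least P)
least-witness {P = P} P? {n} = <-rec (λ n → P n → ∃ (Least P)) search n
  where
  search : ∀ n → (∀ {k} → k < n → P k → ∃ (Least P)) → P n → ∃ (Least P)
  search n below Pn with anyUpTo? P? n
  ... | yes (k , k<n , Pk) = below k<n Pk
  ... | no  ∄k<n           = n , Pn , λ {d} Pd → ≮⇒≥ λ d<n → ∄k<n (d , d<n , Pd)

alcm-exists : ∀ {a m y} → 0 < y → lcm a y ≡ m → ∃ (IsAlcm a m)
alcm-exists {a} {m} 0<y eq with least-witness (λ d → 0 <? d ×-dec lcm a d ≟ m) (0<y , eq)
... | c , (0<c , eqc) , least = c , 0<c , eqc , λ _ 0<d eqd → least (0<d , eqd)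

alcm-∣ : ∀ {a m c y} → IsAlcm a m c → lcm a y ≡ m → c ∣ y
alcm-∣ {a} {m} {c} {y} (0<c , eqc , least) eqy = subst (_∣ y) g≡c (gcd[m,n]∣n c y)
  where
  g≡c : gcd c y ≡ c
  g≡c = ≤-antisym (∣⇒≤ {{>-nonZero 0<c}} (gcd[m,n]∣m c y))
          (least (gcd c y) (gcd-pos y 0<c) (trans (lcm-gcd-closed a 0<c (trans eqy (sym eqc))) eqc))

mult-C⊗C-scale : ∀ {a x y c t} n → 0 < x → 0 < c → a ∣ x → lcm a y ≡ lcm a c → y ≡ t * c →
                 mult n (C x ⊗ C y) ≡ t * mult n (C x ⊗ C c)
mult-C⊗C-scale {a} {x} {y} {c} {t} n 0<x 0<c a∣x lcm≡ y≡tc = begin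
  mult n (C x ⊗ C y)                   ≡⟨ cong (mult n) (C⊗C x y) ⟩
  mult n (gcd x y · C (lcm x y))
    ≡⟨ cong₂ (λ g l → mult n (g · C l)) (gcd-scale {t = t} 0<x 0<c y≡tc lcm-x≡) lcm-x≡ ⟩
  mult n ((t * gcd x c) · C (lcm x c)) ≡⟨ mult-· n (t * gcd x c) (C (lcm x c)) ⟩
  t * gcd x c * mult n (C (lcm x c))   ≡⟨ *-assoc t (gcd x c) _ ⟩
  t * (gcd x c * mult n (C (lcm x c))) ≡⟨ cong (t *_) (mult-· n (gcd x c) (C (lcm x c))) ⟨
  t * mult n (gcd x c · C (lcm x c))   ≡⟨ cong (λ L → t * mult n L) (C⊗C x c) ⟨
  t * mult n (C x ⊗ C c)               ∎
  where
  lcm-x≡ : lcm x y ≡ lcm x c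
  lcm-x≡ = lcm-≡-lift a∣x lcm≡

mult-⊗-C-scale : ∀ {a y c t} n A → IsPerm A → All (a ∣_) A → 0 < c → lcm a y ≡ lcm a c → y ≡ t * c →
                 mult n (A ⊗ C y) ≡ t * mult n (A ⊗ C c)
mult-⊗-C-scale {t = t} n [] _ _ _ _ _ = sym (*-zeroʳ t)
mult-⊗-C-scale {y = y} {c} {t} n (x ∷ A) (0<x ∷ A-perm) (a∣x ∷ a∣A) 0<c lcm≡ y≡tc = begin
  mult n ((x ∷ A) ⊗ C y)                        ≡⟨ mult-⊗-∷ˡ n x A (C y) ⟩
  mult n (C x ⊗ C y) + mult n (A ⊗ C y)
    ≡⟨ cong₂ _+_ (mult-C⊗C-scale {t = t} n 0<x 0<c a∣x lcm≡ y≡tc)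
                 (mult-⊗-C-scale {t = t} n A A-perm a∣A 0<c lcm≡ y≡tc) ⟩
  t * mult n (C x ⊗ C c) + t * mult n (A ⊗ C c) ≡⟨ *-distribˡ-+ t _ _ ⟨
  t * (mult n (C x ⊗ C c) + mult n (A ⊗ C c))   ≡⟨ cong (t *_) (mult-⊗-∷ˡ n x A (C c)) ⟨
  t * mult n ((x ∷ A) ⊗ C c)                    ∎

-- The division procedure

MaximalQuotient : Perm → Perm → Set
MaximalQuotient A B =
  ∃ λ X → Runs A B X × IsSolution A B X × (∀ Y → IsSolution A B Y → components Y ≤ components X)

module Division (A : Perm) (A-perm : IsPerm A) (ℓA∈A : ℓ A ∈ A) (ℓA∣A : All (ℓ A ∣_) A) where

  a : ℕ
  a = ℓ A

  0<a : 0 < a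
  0<a = lookup A-perm ℓA∈A

  Hits : ℕ → Pred ℕ _
  Hits m y = lcm a y ≡ m

  hits? : ∀ m → Decidable (Hits m)
  hits? m y = lcm a y ≟ m

  hits misses : ℕ → Perm → Perm
  hits   m = filter (hits? m)
  misses m = filter (∁? (hits? m))

  multiple-of-⊗-C : ∀ {m c} → IsAlcm a m c → ∀ Y → IsPerm Y → All (Hits m) Y →
                    ∃ λ K → components Y ≤ K × (∀ n → mult n (A ⊗ Y) ≡ K * mult n (A ⊗ C c))
  multiple-of-⊗-C alc [] [] [] = 0 , z≤n , λ n → cong (mult n) (⊗-zeroʳ A)
  multiple-of-⊗-C {c = c} alc@(0<c , lcm≡m , _) (y ∷ Y) (0<y ∷ Y-perm) (hit ∷ all-hit)
    with alcm-∣ {a = a} alc hit | multiple-of-⊗-C alc Y Y-perm all-hit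
  ... | divides t y≡tc | K , |Y|≤K , eqK = t + K , +-mono-≤ 1≤t |Y|≤K , λ n → begin
    mult n (A ⊗ (y ∷ Y))              ≡⟨ mult-⊗-∷ʳ n A y Y ⟩
    mult n (A ⊗ C y) + mult n (A ⊗ Y)
      ≡⟨ cong₂ _+_ (mult-⊗-C-scale {t = t} n A A-perm ℓA∣A 0<c (trans hit (sym lcm≡m)) y≡tc) (eqK n) ⟩
    t * mult n P + K * mult n P       ≡⟨ *-distribʳ-+ (mult n P) t K ⟨
    (t + K) * mult n P                ∎
    where
    P = A ⊗ C c
    1≤t : 1 ≤ t
    1≤t = n≢0⇒n>0 λ { refl → n>0⇒n≢0 0<y y≡tc }

  ℓ≤lcm : ∀ {B Y y} → A ⊗ Y ↭ B → y ∈ Y → ℓ B ≤ lcm a y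
  ℓ≤lcm {B} AY↭B y∈Y = ℓ-≤ B (∈-resp-↭ AY↭B (∈-⊗⁺ ℓA∈A y∈Y (gcd-pos _ 0<a)))

  hit-from-product : ∀ {B Y x y} → IsSolution A B Y → x ∈ A → y ∈ Y → lcm x y ≡ ℓ B → Hits (ℓ B) y
  hit-from-product {y = y} (Y-perm , AY↭B) x∈A y∈Y eq = ≤-antisym
    (∣⇒≤ {{>-nonZero 0<ℓB}} (subst (lcm a y ∣_) eq (lcm-monoˡ-∣ y (lookup ℓA∣A x∈A))))
    (ℓ≤lcm AY↭B y∈Y)
    where
    0<ℓB = subst (0 <_) eq (lcm-pos (lookup A-perm x∈A) (lookup Y-perm y∈Y))

  ∃-hit : ∀ {B Y} → IsSolution A B Y → ℓ B ∈ B → ∃ λ y → y ∈ Y × Hits (ℓ B) y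
  ∃-hit {Y = Y} solY@(_ , AY↭B) ℓB∈B with ∈-⊗⁻ A Y (∈-resp-↭ (↭-sym AY↭B) ℓB∈B)
  ... | x , y , x∈A , y∈Y , eq = y , y∈Y , hit-from-product solY x∈A y∈Y eq

  misses-avoid-ℓ : ∀ {B Y} → IsSolution A B Y → mult (ℓ B) (A ⊗ misses (ℓ B) Y) ≡ 0
  misses-avoid-ℓ {B} {Y} solY = ∉⇒mult≡0 λ ℓB∈ →
    let x , y , x∈A , y∈misses , eq = ∈-⊗⁻ A (misses (ℓ B) Y) ℓB∈
        y∈Y , ¬hit = ∈-filter⁻ (∁? (hits? (ℓ B))) y∈misses
    in ¬hit (hit-from-product solY x∈A y∈Y eq)

  record Peeling (B Y : Perm) (c : ℕ) : Set where
    field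
      copies      : ℕ
      hits≤copies : components (hits (ℓ B) Y) ≤ copies
      mult-split  : ∀ n → mult n B ≡ copies * mult n (A ⊗ C c) + mult n (A ⊗ misses (ℓ B) Y)
      copies-spec : copies * mult (ℓ B) (A ⊗ C c) ≡ mult (ℓ B) B

  peel : ∀ {B Y c} → IsSolution A B Y → IsAlcm a (ℓ B) c → Peeling B Y c
  peel {B} {Y} {c} solY@(Y-perm , AY↭B) alc
    with multiple-of-⊗-C alc (hits (ℓ B) Y) (filter⁺ (hits? (ℓ B)) Y-perm) (all-filter (hits? (ℓ B)) Y)
  ... | K , |hits|≤K , eqK = record
    { copies = K ; hits≤copies = |hits|≤K ; mult-split = split ; copies-spec = spec }
    where
    m = ℓ B
    P = A ⊗ C c
    split : ∀ n → mult n B ≡ K * mult n P + mult n (A ⊗ misses m Y)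
    split n = begin
      mult n B                                        ≡⟨ ↭⇒mult≡ AY↭B n ⟨
      mult n (A ⊗ Y)                                  ≡⟨ mult-⊗-filter (hits? m) n A Y ⟩
      mult n (A ⊗ hits m Y) + mult n (A ⊗ misses m Y) ≡⟨ cong (_+ mult n (A ⊗ misses m Y)) (eqK n) ⟩
      K * mult n P + mult n (A ⊗ misses m Y)          ∎
    spec : K * mult m P ≡ mult m B
    spec = begin
      K * mult m P                           ≡⟨ +-identityʳ (K * mult m P) ⟨
      K * mult m P + 0                       ≡⟨ cong (K * mult m P +_) (misses-avoid-ℓ solY) ⟨
      K * mult m P + mult m (A ⊗ misses m Y) ≡⟨ split m ⟨
      mult m B                               ∎

  module Step {B Y c y₀} (B≢𝟘 : B ≢ 𝟘) (solY : IsSolution A B Y)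
              (y₀∈Y : y₀ ∈ Y) (hit : Hits (ℓ B) y₀) (alc : IsAlcm a (ℓ B) c) where

    open Peeling (peel solY alc)

    m : ℕ
    m = ℓ B

    P B′ : Perm
    P  = A ⊗ C c
    B′ = A ⊗ misses m Y

    0<c : 0 < c
    0<c = proj₁ alc

    0<mult-P : 0 < mult m P
    0<mult-P = ∈⇒mult>0
      (subst (_∈ P) (proj₁ (proj₂ alc)) (∈-⊗⁺ {A = A} {Y = C c} ℓA∈A (here refl) (gcd-pos c 0<a)))

    0<copies : 0 < copies
    0<copies = <-≤-trans (filter-some (hits? m) (Any.map (λ { refl → hit }) y₀∈Y)) hits≤copies

    misses-shorter : components (misses m Y) < components Y
    misses-shorter = filter-notAll (∁? (hits? m)) Y (Any.map (λ { refl ¬hit → ¬hit hit }) y₀∈Y)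

    B↭ : B ↭ (copies · P) ⊕ B′
    B↭ = mult≡⇒↭ B _ λ n → begin
      mult n B                        ≡⟨ mult-split n ⟩
      copies * mult n P + mult n B′   ≡⟨ cong (_+ mult n B′) (mult-· n copies P) ⟨
      mult n (copies · P) + mult n B′ ≡⟨ mult-⊕ n (copies · P) B′ ⟨
      mult n ((copies · P) ⊕ B′)      ∎

    size-A≤size-B : size A ≤ size B
    size-A≤size-B = ≤-trans (m≤m*n (size A) c {{>-nonZero 0<c}})
      (≤-trans (≤-reflexive (sym (size-⊗-C A c))) (⊑⇒size≤ (·-⊑ 0<copies B↭)))

    copies-unique : ∀ {Z} (solZ : IsSolution A B Z) → Peeling.copies (peel solZ alc) ≡ copies
    copies-unique solZ = *-cancelʳ-≡ _ copies (mult m P) {{>-nonZero 0<mult-P}}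
      (trans (Peeling.copies-spec (peel solZ alc)) (sym copies-spec))

    misses-solution : ∀ {Z} → IsSolution A B Z → IsSolution A B′ (misses m Z)
    misses-solution {Z} solZ@(Z-perm , _) =
      filter⁺ (∁? (hits? m)) Z-perm , mult≡⇒↭ _ B′ λ n → +-cancelˡ-≡ (copies * mult n P) _ _ (begin
        copies * mult n P + mult n (A ⊗ misses m Z)
          ≡⟨ cong (λ k → k * mult n P + mult n (A ⊗ misses m Z)) (copies-unique solZ) ⟨
        Z.copies * mult n P + mult n (A ⊗ misses m Z) ≡⟨ Z.mult-split n ⟨
        mult n B                                      ≡⟨ mult-split n ⟩
        copies * mult n P + mult n B′                 ∎)
      where module Z = Peeling (peel solZ alc)

    extend : MaximalQuotient A B′ → MaximalQuotient A B
    extend (X′ , runs′ , (X′-perm , AX′↭B′) , maximal′) = X , runs , (X-perm , AX↭B) , maximal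
      where
      X : Perm
      X = (copies · C c) ⊕ X′

      runs : Runs A B X
      runs = step {B' = B′} {k = copies} B≢𝟘 alc copies-spec
                  (≤⇒≯ size-A≤size-B) (·-⊑ 0<copies B↭) B↭ runs′

      X-perm : IsPerm X
      X-perm = ++⁺ (All-· copies (0<c ∷ [])) X′-perm

      AX↭B : A ⊗ X ↭ B
      AX↭B = mult≡⇒↭ _ B λ n → begin
        mult n (A ⊗ X)                                ≡⟨ mult-⊗-⊕ʳ n A (copies · C c) X′ ⟩
        mult n (A ⊗ (copies · C c)) + mult n (A ⊗ X′)
          ≡⟨ cong₂ _+_ (mult-⊗-·ʳ n A copies (C c)) (↭⇒mult≡ AX′↭B′ n) ⟩
        copies * mult n P + mult n B′                 ≡⟨ mult-split n ⟨
        mult n B                                      ∎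

      |X| : components X ≡ copies + components X′
      |X| = trans (length-++ (copies · C c)) (cong (_+ components X′) (components-·-C copies c))

      maximal : ∀ Z → IsSolution A B Z → components Z ≤ components X
      maximal Z solZ = ≤-trans (≤-reflexive (length-filter-∁ (hits? m) Z))
        (≤-trans (+-mono-≤ hits≤ (maximal′ (misses m Z) (misses-solution solZ))) (≤-reflexive (sym |X|)))
        where
        hits≤ : components (hits m Z) ≤ copies
        hits≤ = subst (components (hits m Z) ≤_) (copies-unique solZ) (Peeling.hits≤copies (peel solZ alc))

  𝟘-solutions-empty : ∀ Z → IsSolution A 𝟘 Z → components Z ≤ 0
  𝟘-solutions-empty []      _ = z≤n
  𝟘-solutions-empty (z ∷ Z) (_ , AZ↭𝟘)
    with ∈-resp-↭ AZ↭𝟘 (∈-⊗⁺ {A = A} {Y = z ∷ Z} ℓA∈A (here refl) (gcd-pos z 0<a))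
  ... | ()

  maximal-quotient : ∀ n B Y → IsSolution A B Y → components Y < n → MaximalQuotient A B
  maximal-quotient _       []         _ _    _ =
    𝟘 , done , ([] , ↭-reflexive (⊗-zeroʳ A)) , 𝟘-solutions-empty
  maximal-quotient zero    (_ ∷ _)    _ _    ()
  maximal-quotient (suc n) B@(b ∷ B₀) Y solY |Y|<1+n with ∃-hit solY (ℓ-∈ b B₀)
  ... | y₀ , y₀∈Y , hit with alcm-exists {a = a} (lookup (proj₁ solY) y₀∈Y) hit
  ... | c , alc = extend (maximal-quotient n B′ (misses m Y) (misses-solution solY)
                                           (<-≤-trans misses-shorter (≤-pred |Y|<1+n)))
    where open Step (λ ()) solY y₀∈Y hit alc

theorem22 : (A B : Perm) → IsPerm A → IsPerm B → PseudoCancelable A →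
    (∃ λ Y → IsSolution A B Y) →
    ∃ λ X → Runs A B X × IsSolution A B X ×
      (∀ Y → IsSolution A B Y → components Y ≤ components X)
theorem22 []      _ _      _ (A≢𝟘 , _)   _          = contradiction refl A≢𝟘
theorem22 (x ∷ A) B A-perm _ (_ , ℓA∣A) (Y , solY) =
  Division.maximal-quotient (x ∷ A) A-perm (ℓ-∈ x A) ℓA∣A
    (suc (components Y)) B Y solY (n<1+n (components Y))
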